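{- Let $\mathcal{C}$ be a locally cartesian closed category with a map $\pi\colon\widetilde{\mathcal{U}}\to\mathcal{U}$ and a monomorphism $\iota\colon\partial\mathsf{Cof}\hookrightarrow\mathsf{Cof}$, and suppose $\iota$ is equipped with a bottom structure $\bot$ relative to $\pi$. Let $E\to B$ be a $\pi$-fibration such that $[\bot,B]\cong1$. Then: (1) $\bot$ is also a bottom structure relative to $E\to B$, i.e. $[\bot,E]\cong[\bot,B]\cong1$; (2) in particular, if moreover $B\to1$ is also a $\pi$-fibration, then $\iota$ has a bottom structure relative to $E\to B$.
   Context: $[X,Y]$ denotes the internal hom and $1$ the terminal object. A $\pi$-fibration is a map arising as a pullback of $\pi$. A pre-bottom structure on $\iota$ is a map $\ulcorner\bot\urcorner\colon1\to\mathsf{Cof}$ such that the object $\bot$ obtained by pulling back $\iota$ along it satisfies $[\bot,\partial\mathsf{Cof}]\cong[\bot,\mathsf{Cof}]\cong1$; it is a bottom structure relative to a map $X\to Y$ if moreover $[\bot,X]\cong[\bot,Y]\cong1$. -}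

module Defs where

open import Level using (Level; _⊔_) renaming (suc to lsuc)
open import Data.Product using (Σ; _×_; _,_)
open import Relation.Binary using (IsEquivalence)

record Category (o ℓ e : Level) : Set (lsuc (o ⊔ ℓ ⊔ e)) where
  infixr 9 _∘_
  infix 4 _≈_
  infixr 4 _⇒_
  field
    Obj       : Set o
    _⇒_       : Obj → Obj → Set ℓ
    _≈_       : ∀ {A B} → A ⇒ B → A ⇒ B → Set e
    ≈-equiv   : ∀ {A B} → IsEquivalence (_≈_ {A} {B})
    id        : ∀ {A} → A ⇒ A
    _∘_       : ∀ {A B C} → B ⇒ C → A ⇒ B → A ⇒ C
    assoc     : ∀ {A B C D} {f : A ⇒ B} {g : B ⇒ C} {h : C ⇒ D} →
                (h ∘ g) ∘ f ≈ h ∘ (g ∘ f)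
    identityˡ : ∀ {A B} {f : A ⇒ B} → id ∘ f ≈ f
    identityʳ : ∀ {A B} {f : A ⇒ B} → f ∘ id ≈ f
    ∘-resp-≈  : ∀ {A B C} {f h : B ⇒ C} {g i : A ⇒ B} →
                f ≈ h → g ≈ i → f ∘ g ≈ h ∘ i

module _ {o ℓ e : Level} (C : Category o ℓ e) where
  open Category C

  Mono : ∀ {A B} → A ⇒ B → Set (o ⊔ ℓ ⊔ e)
  Mono {A} f = ∀ {X} (g h : X ⇒ A) → f ∘ g ≈ f ∘ h → g ≈ h

  record _≅_ (A B : Obj) : Set (ℓ ⊔ e) where
    field
      from  : A ⇒ B
      to    : B ⇒ A
      isoˡ  : to ∘ from ≈ id
      isoʳ  : from ∘ to ≈ id

  record Terminal : Set (o ⊔ ℓ ⊔ e) where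
    field
      ⊤        : Obj
      !        : ∀ {A} → A ⇒ ⊤
      !-unique : ∀ {A} (f : A ⇒ ⊤) → f ≈ !

  record IsPullback {P A B D : Obj} (p₁ : P ⇒ A) (p₂ : P ⇒ B)
                    (f : A ⇒ D) (g : B ⇒ D) : Set (o ⊔ ℓ ⊔ e) where
    field
      commute     : f ∘ p₁ ≈ g ∘ p₂
      universal   : ∀ {Q} (h₁ : Q ⇒ A) (h₂ : Q ⇒ B) → f ∘ h₁ ≈ g ∘ h₂ → Q ⇒ P
      p₁∘universal : ∀ {Q} {h₁ : Q ⇒ A} {h₂ : Q ⇒ B} {eq : f ∘ h₁ ≈ g ∘ h₂} →
                     p₁ ∘ universal h₁ h₂ eq ≈ h₁
      p₂∘universal : ∀ {Q} {h₁ : Q ⇒ A} {h₂ : Q ⇒ B} {eq : f ∘ h₁ ≈ g ∘ h₂} →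
                     p₂ ∘ universal h₁ h₂ eq ≈ h₂
      unique      : ∀ {Q} {h₁ : Q ⇒ A} {h₂ : Q ⇒ B} {eq : f ∘ h₁ ≈ g ∘ h₂}
                    (u : Q ⇒ P) → p₁ ∘ u ≈ h₁ → p₂ ∘ u ≈ h₂ →
                    u ≈ universal h₁ h₂ eq

  record Pullback {A B D : Obj} (f : A ⇒ D) (g : B ⇒ D) : Set (o ⊔ ℓ ⊔ e) where
    field
      P          : Obj
      p₁         : P ⇒ A
      p₂         : P ⇒ B
      isPullback : IsPullback p₁ p₂ f g

  -- Dependent product Π_f g of g : Z → X along f : X → Y, i.e. the value
  -- at g of a right adjoint to pulling back along f, given by its
  -- universal property (using the chosen pullbacks pb).
  record DependentProduct (pb : ∀ {A B D} (f : A ⇒ D) (g : B ⇒ D) → Pullback f g)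
                          {X Y Z : Obj} (f : X ⇒ Y) (g : Z ⇒ X)
                          : Set (o ⊔ ℓ ⊔ e) where
    field
      ΠObj   : Obj
      q      : ΠObj ⇒ Y
      ev     : Pullback.P (pb q f) ⇒ Z
      ev-over : g ∘ ev ≈ Pullback.p₂ (pb q f)
      curry  : ∀ {W} (h : W ⇒ Y) (k : Pullback.P (pb h f) ⇒ Z) →
               g ∘ k ≈ Pullback.p₂ (pb h f) → W ⇒ ΠObj
      q∘curry : ∀ {W} {h : W ⇒ Y} {k : Pullback.P (pb h f) ⇒ Z}
                {eq : g ∘ k ≈ Pullback.p₂ (pb h f)} → q ∘ curry h k eq ≈ h
      -- ev ∘ (curry h k × X) ≈ k, where (curry h k × X) is any (hence the
      -- unique) map of pullbacks over curry h k and X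
      ev∘curry : ∀ {W} {h : W ⇒ Y} {k : Pullback.P (pb h f) ⇒ Z}
                 {eq : g ∘ k ≈ Pullback.p₂ (pb h f)}
                 (m : Pullback.P (pb h f) ⇒ Pullback.P (pb q f)) →
                 Pullback.p₁ (pb q f) ∘ m ≈ curry h k eq ∘ Pullback.p₁ (pb h f) →
                 Pullback.p₂ (pb q f) ∘ m ≈ Pullback.p₂ (pb h f) →
                 ev ∘ m ≈ k
      curry-unique : ∀ {W} {h : W ⇒ Y} {k : Pullback.P (pb h f) ⇒ Z}
                 {eq : g ∘ k ≈ Pullback.p₂ (pb h f)}
                 (u : W ⇒ ΠObj)
                 (m : Pullback.P (pb h f) ⇒ Pullback.P (pb q f)) →
                 q ∘ u ≈ h →
                 Pullback.p₁ (pb q f) ∘ m ≈ u ∘ Pullback.p₁ (pb h f) →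
                 Pullback.p₂ (pb q f) ∘ m ≈ Pullback.p₂ (pb h f) →
                 ev ∘ m ≈ k →
                 u ≈ curry h k eq

  record LCCC : Set (o ⊔ ℓ ⊔ e) where
    field
      terminal : Terminal
      pullback : ∀ {A B D} (f : A ⇒ D) (g : B ⇒ D) → Pullback f g
      Π        : ∀ {X Y Z} (f : X ⇒ Y) (g : Z ⇒ X) → DependentProduct pullback f g

    open Terminal terminal public

    _×ₒ_ : Obj → Obj → Obj
    X ×ₒ Y = Pullback.P (pullback (! {X}) (! {Y}))

    [_,_] : Obj → Obj → Obj
    [ X , Y ] = DependentProduct.ΠObj (Π (! {X}) (Pullback.p₁ (pullback (! {X}) (! {Y}))))

  module _ (L : LCCC) where
    open LCCC L

    IsFibration : ∀ {U Ũ E B} (π : Ũ ⇒ U) (p : E ⇒ B) → Set (o ⊔ ℓ ⊔ e)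
    IsFibration {U} {Ũ} {E} {B} π p =
      Σ (B ⇒ U) λ χ → Σ (E ⇒ Ũ) λ χ̃ → IsPullback χ̃ p π χ

    BotObj : ∀ {∂Cof Cof} (ι : ∂Cof ⇒ Cof) (⌜⊥⌝ : ⊤ ⇒ Cof) → Obj
    BotObj ι ⌜⊥⌝ = Pullback.P (pullback ⌜⊥⌝ ι)

    IsPreBottom : ∀ {∂Cof Cof} (ι : ∂Cof ⇒ Cof) (⌜⊥⌝ : ⊤ ⇒ Cof) → Set (ℓ ⊔ e)
    IsPreBottom {∂Cof} {Cof} ι ⌜⊥⌝ =
      ([ BotObj ι ⌜⊥⌝ , ∂Cof ] ≅ ⊤) × ([ BotObj ι ⌜⊥⌝ , Cof ] ≅ ⊤)

    IsBottomRel : ∀ {∂Cof Cof X Y} (ι : ∂Cof ⇒ Cof) (⌜⊥⌝ : ⊤ ⇒ Cof)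
                  (f : X ⇒ Y) → Set (ℓ ⊔ e)
    IsBottomRel {X = X} {Y = Y} ι ⌜⊥⌝ f =
      IsPreBottom ι ⌜⊥⌝ × ([ BotObj ι ⌜⊥⌝ , X ] ≅ ⊤) × ([ BotObj ι ⌜⊥⌝ , Y ] ≅ ⊤)

    HasBottomRel : ∀ {∂Cof Cof X Y} (ι : ∂Cof ⇒ Cof) (f : X ⇒ Y) → Set (ℓ ⊔ e)
    HasBottomRel {Cof = Cof} ι f = Σ (⊤ ⇒ Cof) λ ⌜⊥⌝ → IsBottomRel ι ⌜⊥⌝ f

{-# OPTIONS --safe #-}
-- [X , Y] ≅ 1 holds iff for every W there is exactly one arrow W × X → Y up to ≈,
-- because transposition is a bijection between arrows W → [X , Y] and W × X → Y.
-- In this form the condition obviously holds for Y = 1, and by the universal property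
-- it passes from the corners A, B, D of a pullback square to its apex (existence of
-- the arrow into the apex uses uniqueness into D). A π-fibration E → B is a pullback
-- of π : Ũ → U, so [⊥ , E] ≅ 1 follows from the conditions on Ũ, U and B; when B → 1
-- is itself a π-fibration, the condition on B follows in the same way from those on
-- Ũ, U and 1.
module Submission where

open import Defs
open import Level using (Level; _⊔_)
open import Data.Product using (_×_; _,_)
open import Function.Bundles using (Inverse)
import Function.Construct.Symmetry as Symmetry
import Function.Consequences.Setoid as FunctionConsequences
open import Relation.Binary using (IsEquivalence; Setoid)
import Relation.Binary.Reasoning.Setoid as SetoidReasoning

record IsSingleton {c ℓ} (S : Setoid c ℓ) : Set (c ⊔ ℓ) where
  open Setoid S
  field
    element : Carrier
    unique  : ∀ x y → x ≈ y

IsSingleton-transport : ∀ {a b ℓ₁ ℓ₂} {S : Setoid a ℓ₁} {T : Setoid b ℓ₂} →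
                        Inverse S T → IsSingleton S → IsSingleton T
IsSingleton-transport {T = T} S↔T S-singleton = record
  { element = to element
  ; unique  = λ x y → begin
      x              ≈⟨ strictlyInverseˡ x ⟨
      to (from x)    ≈⟨ to-cong (unique (from x) (from y)) ⟩
      to (from y)    ≈⟨ strictlyInverseˡ y ⟩
      y              ∎
  }
  where
    open Inverse S↔T
    open IsSingleton S-singleton
    open SetoidReasoning T

module _ {o ℓ e : Level} (C : Category o ℓ e) where
  open Category C
  private
    module ≈ {A B} = IsEquivalence (≈-equiv {A} {B})

  hom-setoid : Obj → Obj → Setoid ℓ e
  hom-setoid A B = record
    { Carrier       = A ⇒ B
    ; _≈_           = _≈_
    ; isEquivalence = ≈-equiv
    }

  private
    module ≈-Reasoning {A B} = SetoidReasoning (hom-setoid A B)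

    ∘-resp-≈ˡ : ∀ {A B D} {f h : B ⇒ D} {g : A ⇒ B} → f ≈ h → f ∘ g ≈ h ∘ g
    ∘-resp-≈ˡ f≈h = ∘-resp-≈ f≈h ≈.refl

    ∘-resp-≈ʳ : ∀ {A B D} {f : B ⇒ D} {g i : A ⇒ B} → g ≈ i → f ∘ g ≈ f ∘ i
    ∘-resp-≈ʳ g≈i = ∘-resp-≈ ≈.refl g≈i

  module _ {P A B D : Obj} {p₁ : P ⇒ A} {p₂ : P ⇒ B} {f : A ⇒ D} {g : B ⇒ D}
           (isPullback : IsPullback C p₁ p₂ f g) where
    open IsPullback isPullback

    IsPullback-unique-diagram : ∀ {W} {h i : W ⇒ P} →
                                p₁ ∘ h ≈ p₁ ∘ i → p₂ ∘ h ≈ p₂ ∘ i → h ≈ i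
    IsPullback-unique-diagram {h = h} {i} p₁h≈p₁i p₂h≈p₂i =
      ≈.trans (unique {eq = commute-at-i} h p₁h≈p₁i p₂h≈p₂i)
              (≈.sym (unique i ≈.refl ≈.refl))
      where
        open ≈-Reasoning
        commute-at-i : f ∘ (p₁ ∘ i) ≈ g ∘ (p₂ ∘ i)
        commute-at-i = begin
          f ∘ (p₁ ∘ i)  ≈⟨ assoc ⟨
          (f ∘ p₁) ∘ i  ≈⟨ ∘-resp-≈ˡ commute ⟩
          (g ∘ p₂) ∘ i  ≈⟨ assoc ⟩
          g ∘ (p₂ ∘ i)  ∎

    IsPullback-hom-isSingleton : ∀ {W} →
      IsSingleton (hom-setoid W A) → IsSingleton (hom-setoid W B) →
      IsSingleton (hom-setoid W D) → IsSingleton (hom-setoid W P)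
    IsPullback-hom-isSingleton A-singleton B-singleton D-singleton = record
      { element = universal (IsSingleton.element A-singleton)
                            (IsSingleton.element B-singleton)
                            (IsSingleton.unique D-singleton _ _)
      ; unique  = λ h i → IsPullback-unique-diagram
                            (IsSingleton.unique A-singleton _ _)
                            (IsSingleton.unique B-singleton _ _)
      }

  module TerminalObject (T : Terminal C) where
    open Terminal T

    !-unique₂ : ∀ {A} (f g : A ⇒ ⊤) → f ≈ g
    !-unique₂ f g = ≈.trans (!-unique f) (≈.sym (!-unique g))

    hom-⊤-isSingleton : ∀ {W} → IsSingleton (hom-setoid W ⊤)
    hom-⊤-isSingleton = record { element = ! ; unique = !-unique₂ }

    ≅⊤⇒hom-isSingleton : ∀ {A} → _≅_ C A ⊤ → ∀ W → IsSingleton (hom-setoid W A)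
    ≅⊤⇒hom-isSingleton A≅⊤ W = record
      { element = to ∘ !
      ; unique  = λ f g → begin
          f                ≈⟨ identityˡ ⟨
          id ∘ f           ≈⟨ ∘-resp-≈ˡ isoˡ ⟨
          (to ∘ from) ∘ f  ≈⟨ assoc ⟩
          to ∘ (from ∘ f)  ≈⟨ ∘-resp-≈ʳ (!-unique₂ _ _) ⟩
          to ∘ (from ∘ g)  ≈⟨ assoc ⟨
          (to ∘ from) ∘ g  ≈⟨ ∘-resp-≈ˡ isoˡ ⟩
          id ∘ g           ≈⟨ identityˡ ⟩
          g                ∎
      }
      where
        open _≅_ A≅⊤
        open ≈-Reasoning

    hom-isSingleton⇒≅⊤ : ∀ {A} → (∀ W → IsSingleton (hom-setoid W A)) → _≅_ C A ⊤
    hom-isSingleton⇒≅⊤ {A} singletons = record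
      { from = !
      ; to   = IsSingleton.element (singletons ⊤)
      ; isoˡ = IsSingleton.unique (singletons A) _ _
      ; isoʳ = !-unique₂ _ _
      }

  module _ (L : LCCC C) where
    open LCCC L
    open TerminalObject terminal

    module _ {A B : Obj} where
      private
        module A×B = IsPullback (Pullback.isPullback (pullback (! {A}) (! {B})))

      π₁ : A ×ₒ B ⇒ A
      π₁ = Pullback.p₁ (pullback ! !)

      π₂ : A ×ₒ B ⇒ B
      π₂ = Pullback.p₂ (pullback ! !)

      ⟨_,_⟩ : ∀ {W} → W ⇒ A → W ⇒ B → W ⇒ A ×ₒ B
      ⟨ f , g ⟩ = A×B.universal f g (!-unique₂ _ _)

      π₁∘⟨⟩ : ∀ {W} {f : W ⇒ A} {g : W ⇒ B} → π₁ ∘ ⟨ f , g ⟩ ≈ f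
      π₁∘⟨⟩ = A×B.p₁∘universal

      π₂∘⟨⟩ : ∀ {W} {f : W ⇒ A} {g : W ⇒ B} → π₂ ∘ ⟨ f , g ⟩ ≈ g
      π₂∘⟨⟩ = A×B.p₂∘universal

      ⟨⟩-unique : ∀ {W} {f : W ⇒ A} {g : W ⇒ B} {h : W ⇒ A ×ₒ B} →
                  π₁ ∘ h ≈ f → π₂ ∘ h ≈ g → h ≈ ⟨ f , g ⟩
      ⟨⟩-unique = A×B.unique _

    module _ {X Y : Obj} where
      private
        module Exp = DependentProduct (Π (! {X}) (π₁ {X} {Y}))
        module Ev = IsPullback (Pullback.isPullback (pullback Exp.q (! {X})))
        open ≈-Reasoning

      -- The domain of ev is a pullback of q and !, not the chosen product [ X , Y ] ×ₒ X.
      _×id : ∀ {W} → W ⇒ [ X , Y ] → W ×ₒ X ⇒ Pullback.P (pullback Exp.q (! {X}))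
      a ×id = Ev.universal (a ∘ π₁) π₂ (!-unique₂ _ _)

      uncurry : ∀ {W} → W ⇒ [ X , Y ] → W ×ₒ X ⇒ Y
      uncurry a = π₂ ∘ (Exp.ev ∘ a ×id)

      curry : ∀ {W} → W ×ₒ X ⇒ Y → W ⇒ [ X , Y ]
      curry g = Exp.curry ! ⟨ π₂ , g ⟩ π₁∘⟨⟩

      ev∘×id : ∀ {W} (a : W ⇒ [ X , Y ]) → Exp.ev ∘ a ×id ≈ ⟨ π₂ , uncurry a ⟩
      ev∘×id a = ⟨⟩-unique first-component ≈.refl
        where
          first-component : π₁ ∘ (Exp.ev ∘ a ×id) ≈ π₂
          first-component = begin
            π₁ ∘ (Exp.ev ∘ a ×id)                   ≈⟨ assoc ⟨
            (π₁ ∘ Exp.ev) ∘ a ×id                   ≈⟨ ∘-resp-≈ˡ Exp.ev-over ⟩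
            Pullback.p₂ (pullback Exp.q !) ∘ a ×id  ≈⟨ Ev.p₂∘universal ⟩
            π₂                                      ∎

      uncurry⇒curry : ∀ {W} {a : W ⇒ [ X , Y ]} {g : W ×ₒ X ⇒ Y} →
                      uncurry a ≈ g → a ≈ curry g
      uncurry⇒curry {a = a} uncurry-a≈g =
        Exp.curry-unique a (a ×id) (!-unique₂ _ _) Ev.p₁∘universal Ev.p₂∘universal
          (≈.trans (ev∘×id a) (⟨⟩-unique π₁∘⟨⟩ (≈.trans π₂∘⟨⟩ uncurry-a≈g)))

      uncurry-curry : ∀ {W} (g : W ×ₒ X ⇒ Y) → uncurry (curry g) ≈ g
      uncurry-curry g = begin
        π₂ ∘ (Exp.ev ∘ curry g ×id)
          ≈⟨ ∘-resp-≈ʳ (Exp.ev∘curry _ Ev.p₁∘universal Ev.p₂∘universal) ⟩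
        π₂ ∘ ⟨ π₂ , g ⟩
          ≈⟨ π₂∘⟨⟩ ⟩
        g ∎

      uncurry-cong : ∀ {W} {a b : W ⇒ [ X , Y ]} → a ≈ b → uncurry a ≈ uncurry b
      uncurry-cong a≈b = ∘-resp-≈ʳ (∘-resp-≈ʳ
        (Ev.unique _ (≈.trans Ev.p₁∘universal (∘-resp-≈ˡ a≈b)) Ev.p₂∘universal))

      curry-cong : ∀ {W} {g h : W ×ₒ X ⇒ Y} → g ≈ h → curry g ≈ curry h
      curry-cong g≈h = uncurry⇒curry (≈.trans (uncurry-curry _) g≈h)

      uncurry-↔ : ∀ {W} → Inverse (hom-setoid W [ X , Y ]) (hom-setoid (W ×ₒ X) Y)
      uncurry-↔ {W} = record
        { to        = uncurry
        ; from      = curry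
        ; to-cong   = uncurry-cong
        ; from-cong = curry-cong
        ; inverse   = strictlyInverseˡ⇒inverseˡ uncurry-cong uncurry-curry
                    , strictlyInverseʳ⇒inverseʳ curry-cong
                        (λ a → ≈.sym (uncurry⇒curry ≈.refl))
        }
        where open FunctionConsequences (hom-setoid W [ X , Y ]) (hom-setoid (W ×ₒ X) Y)

    [,]≅⊤⇒×-hom-isSingleton : ∀ {X Y} → _≅_ C [ X , Y ] ⊤ →
                              ∀ W → IsSingleton (hom-setoid (W ×ₒ X) Y)
    [,]≅⊤⇒×-hom-isSingleton [X,Y]≅⊤ W =
      IsSingleton-transport uncurry-↔ (≅⊤⇒hom-isSingleton [X,Y]≅⊤ W)

    ×-hom-isSingleton⇒[,]≅⊤ : ∀ {X Y} → (∀ W → IsSingleton (hom-setoid (W ×ₒ X) Y)) →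
                              _≅_ C [ X , Y ] ⊤
    ×-hom-isSingleton⇒[,]≅⊤ singletons = hom-isSingleton⇒≅⊤ λ W →
      IsSingleton-transport (Symmetry.inverse uncurry-↔) (singletons W)

    [,⊤]≅⊤ : ∀ {X} → _≅_ C [ X , ⊤ ] ⊤
    [,⊤]≅⊤ = ×-hom-isSingleton⇒[,]≅⊤ λ _ → hom-⊤-isSingleton

    IsPullback-[,]≅⊤ : ∀ {X P A B D} {p₁ : P ⇒ A} {p₂ : P ⇒ B} {f : A ⇒ D} {g : B ⇒ D} →
                       IsPullback C p₁ p₂ f g →
                       _≅_ C [ X , A ] ⊤ → _≅_ C [ X , B ] ⊤ → _≅_ C [ X , D ] ⊤ →
                       _≅_ C [ X , P ] ⊤
    IsPullback-[,]≅⊤ isPullback [X,A]≅⊤ [X,B]≅⊤ [X,D]≅⊤ = ×-hom-isSingleton⇒[,]≅⊤ λ W →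
      IsPullback-hom-isSingleton isPullback
        ([,]≅⊤⇒×-hom-isSingleton [X,A]≅⊤ W)
        ([,]≅⊤⇒×-hom-isSingleton [X,B]≅⊤ W)
        ([,]≅⊤⇒×-hom-isSingleton [X,D]≅⊤ W)

-- Only the object ⊥ matters.
lemma2p11 : ∀ {o ℓ e : Level} (C : Category o ℓ e) (L : LCCC C) →
    let open Category C
        open LCCC L
    in ∀ {U Ũ Cof ∂Cof : Obj} (π : Ũ ⇒ U) (ι : ∂Cof ⇒ Cof) → Mono C ι →
       (⌜⊥⌝ : ⊤ ⇒ Cof) → IsBottomRel C L ι ⌜⊥⌝ π →
       (∀ {E B : Obj} (p : E ⇒ B) → IsFibration C L π p →
          _≅_ C [ BotObj C L ι ⌜⊥⌝ , B ] ⊤ →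
          IsBottomRel C L ι ⌜⊥⌝ p)
       ×
       (∀ {E B : Obj} (p : E ⇒ B) → IsFibration C L π p →
          IsFibration C L π (! {B}) →
          HasBottomRel C L ι p)
lemma2p11 C L π ι _ ⌜⊥⌝ (preBottom , [⊥,Ũ]≅⊤ , [⊥,U]≅⊤) =
  bottomRel-fibration , λ p p-fibration (_ , _ , B-pullback) →
    ⌜⊥⌝ , bottomRel-fibration p p-fibration
            (IsPullback-[,]≅⊤ C L B-pullback [⊥,Ũ]≅⊤ ([,⊤]≅⊤ C L) [⊥,U]≅⊤)
  where
    open Category C
    open LCCC L

    bottomRel-fibration : ∀ {E B : Obj} (p : E ⇒ B) → IsFibration C L π p →
                          _≅_ C [ BotObj C L ι ⌜⊥⌝ , B ] ⊤ → IsBottomRel C L ι ⌜⊥⌝ p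
    bottomRel-fibration p (_ , _ , E-pullback) [⊥,B]≅⊤ =
      preBottom , IsPullback-[,]≅⊤ C L E-pullback [⊥,Ũ]≅⊤ [⊥,B]≅⊤ [⊥,U]≅⊤ , [⊥,B]≅⊤
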